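{- A graph $G$ is in $\mathcal{R}_{UVR}$ if and only if every connected component of $G$ is in $\mathcal{R}_{UVR}$.
   Context: All graphs are finite, simple and undirected. A Roman dominating function (RDF) on a graph $G$ is a map $f:V(G)\to\{0,1,2\}$ such that every vertex $v$ with $f(v)=0$ has a neighbor $u$ with $f(u)=2$. Its weight is $\sum_{v\in V(G)} f(v)$. The Roman domination number $\gamma_R(G)$ is the minimum weight of an RDF on $G$. $\mathcal{R}_{UVR}$ is the class of graphs $G$ such that $\gamma_R(G-v)=\gamma_R(G)$ for all $v\in V(G)$. -}

module Defs where

open import Data.Nat using (ℕ; zero; suc; _≤_)
open import Data.Fin using (Fin; zero; suc; punchIn; toℕ)
open import Data.Bool using (Bool; true; false)
open import Data.Vec using (tabulate; sum)
open import Data.Product using (Σ; ∃; _×_; _,_)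
open import Data.Unit using (⊤)
open import Relation.Binary.PropositionalEquality using (_≡_)
open import Function.Definitions using (Injective)

record Graph (n : ℕ) : Set where
  field
    adj    : Fin n → Fin n → Bool
    sym    : ∀ i j → adj i j ≡ adj j i
    irrefl : ∀ i → adj i i ≡ false
open Graph public

deleteVertex : ∀ {m} → Graph (suc m) → Fin (suc m) → Graph m
deleteVertex G v = record
  { adj    = λ i j → adj G (punchIn v i) (punchIn v j)
  ; sym    = λ i j → sym G (punchIn v i) (punchIn v j)
  ; irrefl = λ i → irrefl G (punchIn v i)
  }

RDF : ∀ {n} → Graph n → (Fin n → Fin 3) → Set
RDF {n} G f = ∀ v → f v ≡ zero →
  ∃ λ (u : Fin n) → adj G u v ≡ true × f u ≡ suc (suc zero)

weight : ∀ {n} → (Fin n → Fin 3) → ℕ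
weight f = sum (tabulate (λ v → toℕ (f v)))

IsγR : ∀ {n} → Graph n → ℕ → Set
IsγR G k = (Σ _ λ f → RDF G f × weight f ≡ k)
         × (∀ f → RDF G f → k ≤ weight f)

R-UVR : ∀ {n} → Graph n → Set
R-UVR {zero}  G = ⊤
R-UVR {suc m} G = ∀ (v : Fin (suc m)) (k : ℕ) → IsγR G k → IsγR (deleteVertex G v) k

data Reachable {n} (G : Graph n) : Fin n → Fin n → Set where
  here : ∀ {u} → Reachable G u u
  step : ∀ {u w v} → adj G u w ≡ true → Reachable G w v → Reachable G u v

Connected : ∀ {n} → Graph n → Set
Connected G = ∀ u v → Reachable G u v

-- H (on Fin m) is (an isomorphic copy of) a connected component of G, via e:
-- e is injective, H is the induced subgraph on the image of e, the image is
-- nonempty, closed under adjacency in G, and H is connected.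
IsComponent : ∀ {n m} → Graph n → Graph m → (Fin m → Fin n) → Set
IsComponent {n} {m} G H e =
    1 ≤ m
  × Injective _≡_ _≡_ e
  × (∀ i j → adj H i j ≡ adj G (e i) (e j))
  × (∀ i (w : Fin n) → adj G (e i) w ≡ true → ∃ λ j → e j ≡ w)
  × Connected H

-- γR is invariant under isomorphism and additive over disjoint unions.  If H is a
-- component of G and K is the subgraph induced on the remaining vertices, then
-- G ≅ H ⊕ K and, for a vertex v of H, G - v ≅ (H - v) ⊕ K.  Hence γR(G - v) = γR(G)
-- iff γR(H - v) = γR(H).  This gives one direction at once, and the other because
-- every vertex lies in a component: close {v} under adjacency.

module Submission where

open import Defs renaming (sym to adj-sym)
open import Data.Nat using (ℕ; zero; suc; _+_; _≤_; _<_; _<?_; >-nonZero⁻¹)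
open import Data.Nat.Properties using (+-mono-≤; ≮⇒≥; +-cancelʳ-≡; ≤-antisym; +-0-commutativeMonoid)
open import Data.Nat.Induction using (<-wellFounded)
open import Data.Fin using (Fin; zero; suc; toℕ; punchIn; splitAt; _↑ˡ_; _↑ʳ_; _≟_)
open import Data.Fin.Properties using (any?; all?; nonZeroIndex; splitAt-↑ˡ; splitAt-↑ʳ; +↔⊎)
open import Data.Fin.Permutation as Perm using (Permutation; _⟨$⟩ʳ_; _⟨$⟩ˡ_)
open import Data.Fin.Subset using (Subset; _∈_; _∪_; ⁅_⁆; _⊃_)
open import Data.Fin.Subset.Properties using (_∈?_; x∈⁅x⁆; x∈⁅y⁆⇒x≡y; p⊆p∪q; x∈p∪q⁺; x∈p∪q⁻)
open import Data.Fin.Subset.Induction using (⊃-wellFounded)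
open import Data.Bool using (Bool; true; false)
open import Data.Bool.Properties using (¬-not) renaming (_≟_ to _≟ᵇ_)
open import Data.List using (List; _∷_; length; filter; allFin)
import Data.List as List
import Data.List.Relation.Unary.All as All
open import Data.List.Relation.Unary.Any using (index)
open import Data.List.Relation.Unary.Any.Properties using (lookup-index)
open import Data.List.Relation.Unary.AllPairs using (_∷_)
open import Data.List.Relation.Unary.Unique.Propositional using (Unique)
import Data.List.Relation.Unary.Unique.Propositional.Properties as Unique
open import Data.List.Membership.Propositional.Properties using (∈-lookup; ∈-allFin; ∈-filter⁺; ∈-filter⁻)
open import Data.Vec using (Vec; []; _∷_; _++_; tabulate; sum; lookup)
open import Data.Vec.Properties using (tabulate-cong; sum-++; lookup∘tabulate)
import Data.Vec.Functional as Vector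
open import Data.Vec.Functional.Properties using (lookup-++ˡ; lookup-++ʳ)
open import Algebra.Properties.CommutativeMonoid.Sum +-0-commutativeMonoid using (∑-permute) renaming (sum to ∑)
open import Data.Product using (Σ; ∃; ∃₂; _×_; _,_; proj₁; proj₂)
open import Data.Sum using (_⊎_; inj₁; inj₂; [_,_])
import Data.Sum.Base as Sum
open import Data.Unit using (tt)
open import Function using (_∘_; _⇔_; mk⇔; case_of_)
open import Function.Bundles using (mk⤖; Equivalence)
open import Function.Properties.Bijection using (⤖⇒↔)
open import Function.Construct.Composition using (_↔-∘_)
open import Function.Definitions using (Injective; Surjective)
open import Induction.WellFounded using (Acc; acc)
open import Relation.Nullary using (Dec; yes; no; ¬_; contradiction)
open import Relation.Nullary.Decidable using (_×-dec_; _→-dec_; ¬?; map′; decidable-stable)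
open import Relation.Unary using (Pred; Decidable)
open import Level using (0ℓ)
open import Relation.Binary.PropositionalEquality using (_≡_; refl; sym; trans; cong; cong₂; subst)

private
  variable
    n m q : ℕ

Labelling : ℕ → Set
Labelling n = Fin n → Fin 3

weight-cong : {f g : Labelling n} → (∀ v → f v ≡ g v) → weight f ≡ weight g
weight-cong f≗g = cong sum (tabulate-cong (cong toℕ ∘ f≗g))

tabulate-++ : ∀ {A : Set} (h : Fin (m + q) → A) →
  tabulate h ≡ tabulate (λ (i : Fin m) → h (i ↑ˡ q)) ++ tabulate (λ (j : Fin q) → h (m ↑ʳ j))
tabulate-++ {zero}      h = refl
tabulate-++ {suc m} {q} h = cong (h zero ∷_) (tabulate-++ {m = m} {q = q} (h ∘ suc))

weight-split : (f : Labelling (m + q)) →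
  weight f ≡ weight (λ (i : Fin m) → f (i ↑ˡ q)) + weight (λ (j : Fin q) → f (m ↑ʳ j))
weight-split {m} {q} f =
  trans (cong sum (tabulate-++ {m = m} {q = q} (toℕ ∘ f))) (sum-++ (tabulate (λ (i : Fin m) → toℕ (f (i ↑ˡ q)))))

weight-++ : (g : Labelling m) (h : Labelling q) → weight (g Vector.++ h) ≡ weight g + weight h
weight-++ {m} {q} g h = trans (weight-split {m = m} {q = q} (g Vector.++ h))
  (cong₂ _+_ (weight-cong (lookup-++ˡ g h)) (weight-cong (lookup-++ʳ g h)))

sum∘tabulate : (h : Fin n → ℕ) → sum (tabulate h) ≡ ∑ h
sum∘tabulate {zero}  h = refl
sum∘tabulate {suc n} h = cong (h zero +_) (sum∘tabulate (h ∘ suc))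

weight-permute : (π : Permutation m n) (f : Labelling n) → weight (f ∘ (π ⟨$⟩ʳ_)) ≡ weight f
weight-permute π f = trans (sum∘tabulate (toℕ ∘ f ∘ (π ⟨$⟩ʳ_)))
  (trans (sym (∑-permute (toℕ ∘ f) π)) (sym (sum∘tabulate (toℕ ∘ f))))

data Side (m q : ℕ) : Fin (m + q) → Set where
  left  : ∀ i → Side m q (i ↑ˡ q)
  right : ∀ j → Side m q (m ↑ʳ j)

side : ∀ m (x : Fin (m + q)) → Side m q x
side zero    x       = right x
side (suc m) zero    = left zero
side (suc m) (suc x) with side m x
... | left i  = left (suc i)
... | right j = right j

induced : Graph n → (Fin m → Fin n) → Graph m
induced G e = record
  { adj    = λ i j → adj G (e i) (e j)
  ; sym    = λ i j → adj-sym G (e i) (e j)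
  ; irrefl = λ i → irrefl G (e i)
  }

unionAdj : Graph m → Graph q → Fin m ⊎ Fin q → Fin m ⊎ Fin q → Bool
unionAdj H K (inj₁ i) (inj₁ j) = adj H i j
unionAdj H K (inj₁ i) (inj₂ j) = false
unionAdj H K (inj₂ i) (inj₁ j) = false
unionAdj H K (inj₂ i) (inj₂ j) = adj K i j

infixl 6 _⊕_

_⊕_ : Graph m → Graph q → Graph (m + q)
_⊕_ {m} H K = record
  { adj    = λ i j → unionAdj H K (splitAt m i) (splitAt m j)
  ; sym    = λ i j → unionAdj-sym (splitAt m i) (splitAt m j)
  ; irrefl = λ i → unionAdj-irrefl (splitAt m i)
  }
  where
  unionAdj-sym : ∀ x y → unionAdj H K x y ≡ unionAdj H K y x
  unionAdj-sym (inj₁ i) (inj₁ j) = adj-sym H i j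
  unionAdj-sym (inj₁ i) (inj₂ j) = refl
  unionAdj-sym (inj₂ i) (inj₁ j) = refl
  unionAdj-sym (inj₂ i) (inj₂ j) = adj-sym K i j
  unionAdj-irrefl : ∀ x → unionAdj H K x x ≡ false
  unionAdj-irrefl (inj₁ i) = irrefl H i
  unionAdj-irrefl (inj₂ j) = irrefl K j

module _ {H : Graph m} {K : Graph q} where

  adj-⊕-↑ˡ : ∀ i j → adj (H ⊕ K) (i ↑ˡ q) (j ↑ˡ q) ≡ adj H i j
  adj-⊕-↑ˡ i j = cong₂ (unionAdj H K) (splitAt-↑ˡ m i q) (splitAt-↑ˡ m j q)

  adj-⊕-↑ʳ : ∀ i j → adj (H ⊕ K) (m ↑ʳ i) (m ↑ʳ j) ≡ adj K i j
  adj-⊕-↑ʳ i j = cong₂ (unionAdj H K) (splitAt-↑ʳ m q i) (splitAt-↑ʳ m q j)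

  adj-⊕-↑ʳ↑ˡ : ∀ i j → adj (H ⊕ K) (m ↑ʳ i) (j ↑ˡ q) ≡ false
  adj-⊕-↑ʳ↑ˡ i j = cong₂ (unionAdj H K) (splitAt-↑ʳ m q i) (splitAt-↑ˡ m j q)

  adj-⊕-↑ˡ↑ʳ : ∀ i j → adj (H ⊕ K) (i ↑ˡ q) (m ↑ʳ j) ≡ false
  adj-⊕-↑ˡ↑ʳ i j = cong₂ (unionAdj H K) (splitAt-↑ˡ m i q) (splitAt-↑ʳ m q j)

  RDF-↑ˡ : {f : Labelling (m + q)} → RDF (H ⊕ K) f → RDF H (f ∘ (_↑ˡ q))
  RDF-↑ˡ rf i fi≡0 with rf (i ↑ˡ q) fi≡0
  ... | u , ui , fu≡2 with side m u
  ... | left j  = j , trans (sym (adj-⊕-↑ˡ j i)) ui , fu≡2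
  ... | right j with trans (sym ui) (adj-⊕-↑ʳ↑ˡ j i)
  ... | ()

  RDF-↑ʳ : {f : Labelling (m + q)} → RDF (H ⊕ K) f → RDF K (f ∘ (m ↑ʳ_))
  RDF-↑ʳ rf i fi≡0 with rf (m ↑ʳ i) fi≡0
  ... | u , ui , fu≡2 with side m u
  ... | right j = j , trans (sym (adj-⊕-↑ʳ j i)) ui , fu≡2
  ... | left j with trans (sym ui) (adj-⊕-↑ˡ↑ʳ j i)
  ... | ()

  RDF-++ : {g : Labelling m} {h : Labelling q} → RDF H g → RDF K h → RDF (H ⊕ K) (g Vector.++ h)
  RDF-++ {g} {h} rg rh x gh≡0 with side m x
  ... | left i with rg i (trans (sym (lookup-++ˡ g h i)) gh≡0)
  ...   | u , ui , gu≡2 = u ↑ˡ q , trans (adj-⊕-↑ˡ u i) ui , trans (lookup-++ˡ g h u) gu≡2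
  RDF-++ {g} {h} rg rh x gh≡0 | right j with rh j (trans (sym (lookup-++ʳ g h j)) gh≡0)
  ...   | u , uj , hu≡2 = m ↑ʳ u , trans (adj-⊕-↑ʳ u j) uj , trans (lookup-++ʳ g h u) hu≡2

  IsγR-⊕ : ∀ {a b} → IsγR H a → IsγR K b → IsγR (H ⊕ K) (a + b)
  IsγR-⊕ ((g , rg , wg) , minimalH) ((h , rh , wh) , minimalK) =
    (g Vector.++ h , RDF-++ rg rh , trans (weight-++ g h) (cong₂ _+_ wg wh)) ,
    λ f rf → subst (_ ≤_) (sym (weight-split {m = m} {q = q} f)) (+-mono-≤ (minimalH _ (RDF-↑ˡ rf)) (minimalK _ (RDF-↑ʳ rf)))

splitAt-punchIn-↑ˡ : ∀ (i : Fin (suc m)) (x : Fin (m + q)) →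
  splitAt (suc m) (punchIn (i ↑ˡ q) x) ≡ Sum.map₁ (punchIn i) (splitAt m x)
splitAt-punchIn-↑ˡ             zero    x       = refl
splitAt-punchIn-↑ˡ {suc m}     (suc i) zero    = refl
splitAt-punchIn-↑ˡ {suc m} {q} (suc i) (suc x) with splitAt m x | splitAt-punchIn-↑ˡ {q = q} i x
... | inj₁ j | ih = cong (Sum.map₁ suc) ih
... | inj₂ j | ih = cong (Sum.map₁ suc) ih

infix 4 _≅_

record _≅_ (G : Graph n) (G' : Graph m) : Set where
  field
    bijection    : Permutation n m
    preserve-adj : ∀ i j → adj G' (bijection ⟨$⟩ʳ i) (bijection ⟨$⟩ʳ j) ≡ adj G i j

  vertex : Fin n → Fin m
  vertex = bijection ⟨$⟩ʳ_

open _≅_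

≅-sym : {G : Graph n} {G' : Graph m} → G ≅ G' → G' ≅ G
≅-sym {n} {m} {G' = G'} φ = record
  { bijection    = Perm.flip π
  ; preserve-adj = λ i j → trans (sym (preserve-adj φ (π ⟨$⟩ˡ i) (π ⟨$⟩ˡ j)))
                                 (cong₂ (adj G') (Perm.inverseʳ π) (Perm.inverseʳ π))
  }
  where
  π : Permutation n m
  π = bijection φ

deleteVertex-≅ : {G : Graph (suc n)} {G' : Graph (suc m)} (φ : G ≅ G') (v : Fin (suc n)) →
  deleteVertex G v ≅ deleteVertex G' (vertex φ v)
deleteVertex-≅ {n} {m} {G' = G'} φ v = record
  { bijection    = Perm.remove v π
  ; preserve-adj = λ i j → trans (sym (cong₂ (adj G') (Perm.punchIn-permute π v i) (Perm.punchIn-permute π v j)))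
                                 (preserve-adj φ (punchIn v i) (punchIn v j))
  }
  where
  π : Permutation (suc n) (suc m)
  π = bijection φ

deleteVertex-⊕ : (H : Graph (suc m)) (K : Graph q) (i : Fin (suc m)) →
  deleteVertex H i ⊕ K ≅ deleteVertex (H ⊕ K) (i ↑ˡ q)
deleteVertex-⊕ {m} H K i = record
  { bijection    = Perm.id
  ; preserve-adj = λ x y → trans (cong₂ (unionAdj H K) (splitAt-punchIn-↑ˡ i x) (splitAt-punchIn-↑ˡ i y))
                                 (unionAdj-punchIn (splitAt m x) (splitAt m y))
  }
  where
  unionAdj-punchIn : ∀ x y →
    unionAdj H K (Sum.map₁ (punchIn i) x) (Sum.map₁ (punchIn i) y) ≡ unionAdj (deleteVertex H i) K x y
  unionAdj-punchIn (inj₁ _) (inj₁ _) = refl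
  unionAdj-punchIn (inj₁ _) (inj₂ _) = refl
  unionAdj-punchIn (inj₂ _) (inj₁ _) = refl
  unionAdj-punchIn (inj₂ _) (inj₂ _) = refl

RDF-resp : {G : Graph n} {f g : Labelling n} → (∀ v → f v ≡ g v) → RDF G f → RDF G g
RDF-resp f≗g rf v gv≡0 with rf v (trans (f≗g v) gv≡0)
... | u , uv , fu≡2 = u , uv , trans (sym (f≗g u)) fu≡2

RDF? : (G : Graph n) (f : Labelling n) → Dec (RDF G f)
RDF? G f = all? λ v → (f v ≟ zero) →-dec any? λ u → (adj G u v ≟ᵇ true) ×-dec (f u ≟ suc (suc zero))

RDF-≅ : {G : Graph n} {G' : Graph m} (φ : G ≅ G') {f : Labelling m} → RDF G' f → RDF G (f ∘ vertex φ)
RDF-≅ {G' = G'} φ {f} rf v fv≡0 with rf (vertex φ v) fv≡0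
... | u , uv , fu≡2 =
  bijection φ ⟨$⟩ˡ u ,
  trans (sym (preserve-adj φ _ v)) (trans (cong (λ w → adj G' w (vertex φ v)) (Perm.inverseʳ (bijection φ))) uv) ,
  trans (cong f (Perm.inverseʳ (bijection φ))) fu≡2

IsγR-≅ : {G : Graph n} {G' : Graph m} → G ≅ G' → ∀ {k} → IsγR G k → IsγR G' k
IsγR-≅ {G = G} {G'} φ ((f , rf , wf) , minimal) =
  (f ∘ vertex φ⁻¹ , RDF-≅ φ⁻¹ rf , trans (weight-permute (bijection φ⁻¹) f) wf) ,
  λ g rg → subst (_ ≤_) (weight-permute (bijection φ) g) (minimal (g ∘ vertex φ) (RDF-≅ φ rg))
  where
  φ⁻¹ : G' ≅ G
  φ⁻¹ = ≅-sym φ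

IsγR-unique : {G : Graph n} {a b : ℕ} → IsγR G a → IsγR G b → a ≡ b
IsγR-unique ((f , rf , wf) , minimalA) ((g , rg , wg) , minimalB) =
  ≤-antisym (subst (_ ≤_) wg (minimalA g rg)) (subst (_ ≤_) wf (minimalB f rf))

any-Vec? : ∀ {k} n {P : Pred (Vec (Fin k) n) 0ℓ} → Decidable P → Dec (∃ P)
any-Vec? zero    P? = map′ ([] ,_) (λ { ([] , p) → p }) (P? [])
any-Vec? (suc n) P? = map′ (λ (a , xs , p) → a ∷ xs , p) (λ { (a ∷ xs , p) → a , xs , p })
                           (any? λ a → any-Vec? n λ xs → P? (a ∷ xs))

-- Pass to a strictly lighter RDF while there is one; labellings are searched as vectors,
-- which can be enumerated.
γR-below : (G : Graph n) (f : Labelling n) → RDF G f → Acc _<_ (weight f) → ∃ (IsγR G)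
γR-below {n} G f rf (acc lighter)
  with any-Vec? n (λ xs → RDF? G (lookup xs) ×-dec (weight (lookup xs) <? weight f))
... | yes (xs , rg , lt) = γR-below G (lookup xs) rg (lighter lt)
... | no none = weight f , (f , rf , refl) , λ g rg → ≮⇒≥ λ lt →
  none (tabulate g , RDF-resp {G = G} (λ v → sym (lookup∘tabulate g v)) rg ,
        subst (_< weight f) (sym (weight-cong (lookup∘tabulate g))) lt)

γR-exists : (G : Graph n) → ∃ (IsγR G)
γR-exists G = γR-below G (λ _ → suc zero) (λ _ ()) (<-wellFounded _)

record Enumeration (P : Pred (Fin n) 0ℓ) : Set where
  field
    size      : ℕ
    element   : Fin size → Fin n
    injective : Injective _≡_ _≡_ element
    sound     : ∀ j → P (element j)
    complete  : ∀ {w} → P w → ∃ λ j → element j ≡ w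

lookup-injective : ∀ {A : Set} {xs : List A} → Unique xs → Injective _≡_ _≡_ (List.lookup xs)
lookup-injective {xs = _ ∷ _} _            {zero}  {zero}  _ = refl
lookup-injective {xs = _ ∷ _} (x≢xs ∷ _)  {zero}  {suc j} p = contradiction p (All.lookup x≢xs (∈-lookup j))
lookup-injective {xs = _ ∷ _} (x≢xs ∷ _)  {suc i} {zero}  p = contradiction (sym p) (All.lookup x≢xs (∈-lookup i))
lookup-injective {xs = _ ∷ _} (_ ∷ unique) {suc i} {suc j} p = cong suc (lookup-injective unique p)

enumerate : {P : Pred (Fin n) 0ℓ} → Decidable P → Enumeration P
enumerate {n} P? = record
  { size      = length xs
  ; element   = List.lookup xs
  ; injective = lookup-injective (Unique.filter⁺ P? (Unique.allFin⁺ n))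
  ; sound     = λ j → proj₂ (∈-filter⁻ P? {xs = allFin n} (∈-lookup {xs = xs} j))
  ; complete  = λ Pw → let w∈xs = ∈-filter⁺ P? (∈-allFin _) Pw in index w∈xs , sym (lookup-index w∈xs)
  }
  where xs = filter P? (allFin n)

module _ (G : Graph n) (H : Graph m) (e : Fin m → Fin n) (component : IsComponent G H e) where

  private
    e-injective : Injective _≡_ _≡_ e
    e-injective = proj₁ (proj₂ component)

    e-induced : ∀ i j → adj H i j ≡ adj G (e i) (e j)
    e-induced = proj₁ (proj₂ (proj₂ component))

    e-closed : ∀ i w → adj G (e i) w ≡ true → ∃ λ j → e j ≡ w
    e-closed = proj₁ (proj₂ (proj₂ (proj₂ component)))

    Outside : Pred (Fin n) 0ℓ
    Outside w = ¬ ∃ λ i → e i ≡ w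

    open Enumeration (enumerate {P = Outside} λ w → ¬? (any? λ i → e i ≟ w))
      renaming (element to d; injective to d-injective; sound to d-outside; complete to d-complete)

    no-edge-out : ∀ i j → adj G (e i) (d j) ≡ false
    no-edge-out i j = ¬-not λ edge → d-outside j (e-closed i (d j) edge)

    [e,d] : Fin m ⊎ Fin size → Fin n
    [e,d] = [ e , d ]

    [e,d]-injective : Injective _≡_ _≡_ [e,d]
    [e,d]-injective {inj₁ i} {inj₁ j} p = cong inj₁ (e-injective p)
    [e,d]-injective {inj₁ i} {inj₂ j} p = contradiction (i , p) (d-outside j)
    [e,d]-injective {inj₂ i} {inj₁ j} p = contradiction (j , sym p) (d-outside i)
    [e,d]-injective {inj₂ i} {inj₂ j} p = cong inj₂ (d-injective p)

    [e,d]-surjective : Surjective _≡_ _≡_ [e,d]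
    [e,d]-surjective w with any? (λ i → e i ≟ w)
    ... | yes (i , ei≡w) = inj₁ i , λ { refl → ei≡w }
    ... | no outside     = let (j , dj≡w) = d-complete outside in inj₂ j , λ { refl → dj≡w }

    [e,d]-adj : ∀ x y → adj G ([e,d] x) ([e,d] y) ≡ unionAdj H (induced G d) x y
    [e,d]-adj (inj₁ i) (inj₁ j) = sym (e-induced i j)
    [e,d]-adj (inj₁ i) (inj₂ j) = no-edge-out i j
    [e,d]-adj (inj₂ i) (inj₁ j) = trans (adj-sym G (d i) (e j)) (no-edge-out j i)
    [e,d]-adj (inj₂ i) (inj₂ j) = refl

  splitComponent : ∃₂ λ q (K : Graph q) → Σ (H ⊕ K ≅ G) λ φ → ∀ i → vertex φ (i ↑ˡ q) ≡ e i
  splitComponent = size , induced G d , φ , λ i → cong [e,d] (splitAt-↑ˡ m i size)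
    where
    φ : H ⊕ induced G d ≅ G
    φ = record
      { bijection    = ⤖⇒↔ (mk⤖ {to = [e,d]} ([e,d]-injective , [e,d]-surjective)) ↔-∘ +↔⊎
      ; preserve-adj = λ x y → [e,d]-adj (splitAt m x) (splitAt m y)
      }

module _ {G : Graph n} where

  Reachable-snoc : ∀ {u v w} → Reachable G u v → adj G v w ≡ true → Reachable G u w
  Reachable-snoc here         vw = step vw here
  Reachable-snoc (step ux xv) vw = step ux (Reachable-snoc xv vw)

  Reachable-sym : ∀ {u v} → Reachable G u v → Reachable G v u
  Reachable-sym here                   = here
  Reachable-sym (step {u} {x} ux xv) = Reachable-snoc (Reachable-sym xv) (trans (adj-sym G x u) ux)

  Reachable-trans : ∀ {u v w} → Reachable G u v → Reachable G v w → Reachable G u w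
  Reachable-trans here         vw = vw
  Reachable-trans (step ux xv) vw = step ux (Reachable-trans xv vw)

  record ReachableClosure (v : Fin n) : Set where
    field
      members   : Subset n
      source    : v ∈ members
      reachable : ∀ {w} → w ∈ members → Reachable G v w
      closed    : ∀ {u w} → u ∈ members → adj G u w ≡ true → w ∈ members

  -- Add an endpoint of a boundary edge until there is none; the set grows strictly.
  close : ∀ {v} (S : Subset n) → Acc _⊃_ S → v ∈ S → (∀ {w} → w ∈ S → Reachable G v w) → ReachableClosure v
  close {v} S (acc larger) v∈S reach
    with any? (λ u → any? λ w → u ∈? S ×-dec (adj G u w ≟ᵇ true) ×-dec ¬? (w ∈? S))
  ... | yes (u , w , u∈S , uw , w∉S) =
    close (S ∪ ⁅ w ⁆) (larger (p⊆p∪q ⁅ w ⁆ , w , x∈p∪q⁺ (inj₂ (x∈⁅x⁆ w)) , w∉S)) (p⊆p∪q ⁅ w ⁆ v∈S) reach′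
    where
    reach′ : ∀ {x} → x ∈ S ∪ ⁅ w ⁆ → Reachable G v x
    reach′ {x} x∈ with x∈p∪q⁻ S ⁅ w ⁆ x∈
    ... | inj₁ x∈S  = reach x∈S
    ... | inj₂ x∈w rewrite x∈⁅y⁆⇒x≡y w x∈w = Reachable-snoc (reach u∈S) uw
  ... | no boundary = record
    { members   = S
    ; source    = v∈S
    ; reachable = reach
    ; closed    = λ {u} {w} u∈S uw → decidable-stable (w ∈? S) λ w∉S → boundary (u , w , u∈S , uw , w∉S)
    }

  reachableClosure : (v : Fin n) → ReachableClosure v
  reachableClosure v = close ⁅ v ⁆ (⊃-wellFounded _) (x∈⁅x⁆ v) λ x∈ → case x∈⁅y⁆⇒x≡y v x∈ of λ { refl → here }

  induced-Reachable : {e : Fin m → Fin n} → Injective _≡_ _≡_ e →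
    (∀ i w → adj G (e i) w ≡ true → ∃ λ j → e j ≡ w) →
    ∀ {i j} → Reachable G (e i) (e j) → Reachable (induced G e) i j
  induced-Reachable {e = e} e-injective e-closed = go refl
    where
    go : ∀ {i j x} → e i ≡ x → Reachable G x (e j) → Reachable (induced G e) i j
    go ei≡x here with e-injective ei≡x
    ... | refl = here
    go {i} refl (step ex xy) with e-closed i _ ex
    ... | k , refl = step ex (go refl xy)

componentOf : (G : Graph n) (v : Fin n) →
  ∃₂ λ m (H : Graph m) → Σ (Fin m → Fin n) λ e → IsComponent G H e × ∃ λ i → e i ≡ v
componentOf G v = size , induced G element , element ,
  (>-nonZero⁻¹ size {{nonZeroIndex (proj₁ (complete source))}} , injective , (λ _ _ → refl) , closed′ ,
   λ i j → induced-Reachable injective closed′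
             (Reachable-trans (Reachable-sym (reachable (sound i))) (reachable (sound j)))) ,
  complete source
  where
  open ReachableClosure (reachableClosure {G = G} v)
  open Enumeration (enumerate (_∈? members))
  closed′ : ∀ i w → adj G (element i) w ≡ true → ∃ λ j → element j ≡ w
  closed′ i w ew = complete (closed (sound i) ew)

Unchanged : Graph (suc n) → Fin (suc n) → Set
Unchanged G v = ∀ k → IsγR G k → IsγR (deleteVertex G v) k

Unchanged-⊕ : {G : Graph (suc n)} (H : Graph (suc m)) (K : Graph q) (φ : H ⊕ K ≅ G) (i : Fin (suc m)) →
  Unchanged H i ⇔ Unchanged G (vertex φ (i ↑ˡ q))
Unchanged-⊕ {n} {m} {q} {G} H K φ i = mk⇔
  (λ unchanged k γG → subst (IsγR G-v) (IsγR-unique {G = G} (γ-whole γH) γG) (γ-deleted (unchanged _ γH)))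
  (λ unchanged k γH′ → subst (IsγR (deleteVertex H i))
     (+-cancelʳ-≡ _ _ _ (IsγR-unique {G = G-v} (γ-deleted γH-i) (unchanged _ (γ-whole γH′)))) γH-i)
  where
  G-v : Graph n
  G-v = deleteVertex G (vertex φ (i ↑ˡ q))
  b : ℕ
  b = proj₁ (γR-exists K)
  γK : IsγR K b
  γK = proj₂ (γR-exists K)
  γH : IsγR H (proj₁ (γR-exists H))
  γH = proj₂ (γR-exists H)
  γH-i : IsγR (deleteVertex H i) (proj₁ (γR-exists (deleteVertex H i)))
  γH-i = proj₂ (γR-exists (deleteVertex H i))
  γ-whole : ∀ {a} → IsγR H a → IsγR G (a + b)
  γ-whole γ = IsγR-≅ φ (IsγR-⊕ γ γK)
  γ-deleted : ∀ {a} → IsγR (deleteVertex H i) a → IsγR G-v (a + b)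
  γ-deleted γ = IsγR-≅ (deleteVertex-≅ φ (i ↑ˡ q)) (IsγR-≅ (deleteVertex-⊕ H K i) (IsγR-⊕ γ γK))

R-UVR-component : (G : Graph n) → R-UVR G → ∀ {m} (H : Graph m) (e : Fin m → Fin n) → IsComponent G H e → R-UVR H
R-UVR-component G       _         {zero}  H e _         = tt
R-UVR-component {zero}  G _       {suc m} H e _         = contradiction (e zero) λ ()
R-UVR-component {suc n} G unchanged {suc m} H e component i with splitComponent G H e component
... | q , K , φ , _ = Equivalence.from (Unchanged-⊕ H K φ i) (unchanged (vertex φ (i ↑ˡ q)))

R-UVR-fromComponents : (G : Graph n) → (∀ {m} (H : Graph m) (e : Fin m → Fin n) → IsComponent G H e → R-UVR H) →
  R-UVR G
R-UVR-fromComponents {zero}  G _ = tt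
R-UVR-fromComponents {suc n} G components v with componentOf G v
... | zero  , H , e , component , () , _
... | suc m , H , e , component , i , ei≡v with splitComponent G H e component
...   | q , K , φ , φ-extends-e =
  subst (Unchanged G) (trans (φ-extends-e i) ei≡v)
    (Equivalence.to (Unchanged-⊕ H K φ i) (components H e component i))

mainTheorem1 : ∀ {n} (G : Graph n) →
    (R-UVR G → ∀ {m} (H : Graph m) (e : Fin m → Fin n) → IsComponent G H e → R-UVR H)
    × ((∀ {m} (H : Graph m) (e : Fin m → Fin n) → IsComponent G H e → R-UVR H) → R-UVR G)
mainTheorem1 G = R-UVR-component G , R-UVR-fromComponents G
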